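{- The rule (LC): from $(p\rightsquigarrow\phi)\wedge\Diamond p\to\psi$ infer $\Diamond\phi\to\psi$ (where $p$ is a propositional variable not occurring in $\phi,\psi$) is admissible in $\mathsf{MS^2IC}$: whenever $(p\rightsquigarrow\phi)\wedge\Diamond p\to\psi$ is a theorem of $\mathsf{MS^2IC}$ with $p$ not occurring in $\phi,\psi$, so is $\Diamond\phi\to\psi$.
   Context: Language: propositional variables, $\top,\bot$, $\neg,\wedge,\vee,\to,\leftrightarrow$, a binary connective $\rightsquigarrow$ and a unary modality $\Box$; $\Diamond\phi:=\neg\Box\neg\phi$, $[\forall]\phi:=\top\rightsquigarrow\phi$. $\mathsf{MS^2IC}$: theorems are the least set containing all instances of classical tautologies and of (A1) $(\bot\rightsquigarrow\phi)\wedge(\phi\rightsquigarrow\top)$; (A2) $((\phi\vee\psi)\rightsquigarrow\chi)\leftrightarrow((\phi\rightsquigarrow\chi)\wedge(\psi\rightsquigarrow\chi))$; (A3) $(\phi\rightsquigarrow(\psi\wedge\chi))\leftrightarrow((\phi\rightsquigarrow\psi)\wedge(\phi\rightsquigarrow\chi))$; (A4) $(\phi\rightsquigarrow\psi)\to(\phi\to\psi)$; (A5) $(\phi\rightsquigarrow\psi)\leftrightarrow(\neg\psi\rightsquigarrow\neg\phi)$; (A8) $[\forall]\phi\to[\forall][\forall]\phi$; (A9) $\neg[\forall]\phi\to[\forall]\neg[\forall]\phi$; (A10) $(\phi\rightsquigarrow\psi)\leftrightarrow[\forall](\phi\rightsquigarrow\psi)$; (A11) $[\forall]\phi\to(\neg[\forall]\phi\rightsquigarrow\bot)$;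 (K) $\Box(\phi\to\psi)\to(\Box\phi\to\Box\psi)$; (Add) $(\phi\rightsquigarrow\psi)\to(\Box\phi\rightsquigarrow\Box\psi)$; closed under modus ponens, from $\phi$ infer $[\forall]\phi$, from $\phi$ infer $\Box\phi$. -}

module Defs where

open import Data.Nat using (ℕ)
open import Data.Bool using (Bool; true; false; not; _∧_; _∨_; if_then_else_)
open import Relation.Binary.PropositionalEquality using (_≡_)
open import Relation.Nullary using (¬_)

data Fm : Set where
  var  : ℕ → Fm
  ⊤'   : Fm
  ⊥'   : Fm
  ¬'_  : Fm → Fm
  _∧'_ : Fm → Fm → Fm
  _∨'_ : Fm → Fm → Fm
  _⇒_  : Fm → Fm → Fm
  _⇔_  : Fm → Fm → Fm
  _⇝_  : Fm → Fm → Fm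
  □_   : Fm → Fm

infixr 9 ¬'_ □_
infixl 8 _∧'_
infixl 7 _∨'_
infix  6 _⇝_
infixr 5 _⇒_
infix  4 _⇔_

◇_ : Fm → Fm
◇ φ = ¬' □ (¬' φ)
infixr 9 ◇_

[∀]_ : Fm → Fm
[∀] φ = ⊤' ⇝ φ
infixr 9 [∀]_

eval : (Fm → Bool) → Fm → Bool
eval v (var n)   = v (var n)
eval v ⊤'        = true
eval v ⊥'        = false
eval v (¬' φ)    = not (eval v φ)
eval v (φ ∧' ψ)  = eval v φ ∧ eval v ψ
eval v (φ ∨' ψ)  = eval v φ ∨ eval v ψ
eval v (φ ⇒ ψ)   = not (eval v φ) ∨ eval v ψ
eval v (φ ⇔ ψ)   = if eval v φ then eval v ψ else not (eval v ψ)
eval v (φ ⇝ ψ)   = v (φ ⇝ ψ)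
eval v (□ φ)     = v (□ φ)

-- φ is an instance of a classical tautology: true under every Boolean
-- assignment to its maximal non-Boolean subformulas (variables, ⇝, □).
Taut : Fm → Set
Taut φ = ∀ (v : Fm → Bool) → eval v φ ≡ true

data ⊢_ : Fm → Set where
  taut : ∀ {φ} → Taut φ → ⊢ φ
  A1   : ∀ {φ} → ⊢ ((⊥' ⇝ φ) ∧' (φ ⇝ ⊤'))
  A2   : ∀ {φ ψ χ} → ⊢ (((φ ∨' ψ) ⇝ χ) ⇔ ((φ ⇝ χ) ∧' (ψ ⇝ χ)))
  A3   : ∀ {φ ψ χ} → ⊢ ((φ ⇝ (ψ ∧' χ)) ⇔ ((φ ⇝ ψ) ∧' (φ ⇝ χ)))
  A4   : ∀ {φ ψ} → ⊢ ((φ ⇝ ψ) ⇒ (φ ⇒ ψ))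
  A5   : ∀ {φ ψ} → ⊢ ((φ ⇝ ψ) ⇔ (¬' ψ ⇝ ¬' φ))
  A8   : ∀ {φ} → ⊢ ([∀] φ ⇒ [∀] [∀] φ)
  A9   : ∀ {φ} → ⊢ (¬' [∀] φ ⇒ [∀] ¬' [∀] φ)
  A10  : ∀ {φ ψ} → ⊢ ((φ ⇝ ψ) ⇔ [∀] (φ ⇝ ψ))
  A11  : ∀ {φ} → ⊢ ([∀] φ ⇒ (¬' [∀] φ ⇝ ⊥'))
  K    : ∀ {φ ψ} → ⊢ (□ (φ ⇒ ψ) ⇒ (□ φ ⇒ □ ψ))
  Add  : ∀ {φ ψ} → ⊢ ((φ ⇝ ψ) ⇒ (□ φ ⇝ □ ψ))
  MP   : ∀ {φ ψ} → ⊢ (φ ⇒ ψ) → ⊢ φ → ⊢ ψ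
  Nec∀ : ∀ {φ} → ⊢ φ → ⊢ ([∀] φ)
  Nec□ : ∀ {φ} → ⊢ φ → ⊢ (□ φ)

infix 2 ⊢_

data _occursIn_ (p : ℕ) : Fm → Set where
  here : p occursIn var p
  ¬o   : ∀ {φ} → p occursIn φ → p occursIn (¬' φ)
  ∧l   : ∀ {φ ψ} → p occursIn φ → p occursIn (φ ∧' ψ)
  ∧r   : ∀ {φ ψ} → p occursIn ψ → p occursIn (φ ∧' ψ)
  ∨l   : ∀ {φ ψ} → p occursIn φ → p occursIn (φ ∨' ψ)
  ∨r   : ∀ {φ ψ} → p occursIn ψ → p occursIn (φ ∨' ψ)
  ⇒l   : ∀ {φ ψ} → p occursIn φ → p occursIn (φ ⇒ ψ)
  ⇒r   : ∀ {φ ψ} → p occursIn ψ → p occursIn (φ ⇒ ψ)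
  ⇔l   : ∀ {φ ψ} → p occursIn φ → p occursIn (φ ⇔ ψ)
  ⇔r   : ∀ {φ ψ} → p occursIn ψ → p occursIn (φ ⇔ ψ)
  ⇝l   : ∀ {φ ψ} → p occursIn φ → p occursIn (φ ⇝ ψ)
  ⇝r   : ∀ {φ ψ} → p occursIn ψ → p occursIn (φ ⇝ ψ)
  □o   : ∀ {φ} → p occursIn φ → p occursIn (□ φ)

module Submission where

-- Substituting φ for p fails: it turns the hypothesis into (φ ⇝ φ) ∧ ◇φ → ψ,
-- and φ ⇝ φ is not a theorem. Instead, tr replaces p by φ, fixes p-free
-- formulas, and sends a ⇝-formula mentioning p to a global formula a ⇝ᵗ b that
-- still implies tr a → tr b: it is unfolded along A2, A5 and A3 into smaller
-- cases, and a remaining case becomes (tr a ⇝ tr b) ∨ χ, where the disjunct χ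
-- keeps Add and A8–A11 valid and is [∀](tr a → tr b) by default. Axiom by
-- axiom, tr maps theorems to theorems; the translated hypothesis is
-- (p ⇝ᵗ φ) ∧ ◇φ → ψ, and p ⇝ᵗ φ follows from [∀](φ → φ).

open import Defs
open import Data.Bool using (Bool; true; false; not; _∧_; _∨_; if_then_else_; T)
open import Data.Bool.Properties using (T-≡; T-∧)
open import Data.Empty using (⊥-elim)
open import Data.Fin using (Fin; zero; suc)
open import Data.Nat using (ℕ; zero; suc; _≡ᵇ_)
open import Data.Nat.Properties using (≡ᵇ⇒≡; ≡⇒≡ᵇ)
open import Data.Product using (_×_; _,_; proj₁; proj₂)
open import Data.Vec using (Vec; []; _∷_; lookup; map)
open import Data.Vec.Properties using (lookup-map)
open import Function using (_∘_)
open import Function.Bundles using (Equivalence)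
open import Relation.Binary.PropositionalEquality
  using (_≡_; refl; sym; trans; cong; cong₂; subst)
open import Relation.Nullary using (¬_)

infixr 9 ¬ₛ_
infixl 8 _∧ₛ_
infixl 7 _∨ₛ_
infixr 5 _⇒ₛ_
infix  4 _⇔ₛ_

data Schema (n : ℕ) : Set where
  mv            : Fin n → Schema n
  ⊤ₛ ⊥ₛ         : Schema n
  ¬ₛ_           : Schema n → Schema n
  _∧ₛ_ _∨ₛ_ _⇒ₛ_ _⇔ₛ_ : Schema n → Schema n → Schema n

instantiate : ∀ {n} → Vec Fm n → Schema n → Fm
instantiate σ (mv i)   = lookup σ i
instantiate σ ⊤ₛ       = ⊤'
instantiate σ ⊥ₛ       = ⊥'
instantiate σ (¬ₛ s)   = ¬' instantiate σ s
instantiate σ (s ∧ₛ t) = instantiate σ s ∧' instantiate σ t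
instantiate σ (s ∨ₛ t) = instantiate σ s ∨' instantiate σ t
instantiate σ (s ⇒ₛ t) = instantiate σ s ⇒ instantiate σ t
instantiate σ (s ⇔ₛ t) = instantiate σ s ⇔ instantiate σ t

⟦_⟧ : ∀ {n} → Schema n → Vec Bool n → Bool
⟦ mv i ⟧   ρ = lookup ρ i
⟦ ⊤ₛ ⟧     ρ = true
⟦ ⊥ₛ ⟧     ρ = false
⟦ ¬ₛ s ⟧   ρ = not (⟦ s ⟧ ρ)
⟦ s ∧ₛ t ⟧ ρ = ⟦ s ⟧ ρ ∧ ⟦ t ⟧ ρ
⟦ s ∨ₛ t ⟧ ρ = ⟦ s ⟧ ρ ∨ ⟦ t ⟧ ρ
⟦ s ⇒ₛ t ⟧ ρ = not (⟦ s ⟧ ρ) ∨ ⟦ t ⟧ ρ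
⟦ s ⇔ₛ t ⟧ ρ = if ⟦ s ⟧ ρ then ⟦ t ⟧ ρ else not (⟦ t ⟧ ρ)

eval-instantiate : ∀ {n} v (σ : Vec Fm n) s →
  eval v (instantiate σ s) ≡ ⟦ s ⟧ (map (eval v) σ)
eval-instantiate v σ (mv i)   = sym (lookup-map i (eval v) σ)
eval-instantiate v σ ⊤ₛ       = refl
eval-instantiate v σ ⊥ₛ       = refl
eval-instantiate v σ (¬ₛ s)   = cong not (eval-instantiate v σ s)
eval-instantiate v σ (s ∧ₛ t) = cong₂ _∧_ (eval-instantiate v σ s) (eval-instantiate v σ t)
eval-instantiate v σ (s ∨ₛ t) = cong₂ _∨_ (eval-instantiate v σ s) (eval-instantiate v σ t)
eval-instantiate v σ (s ⇒ₛ t) =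
  cong₂ (λ x y → not x ∨ y) (eval-instantiate v σ s) (eval-instantiate v σ t)
eval-instantiate v σ (s ⇔ₛ t) =
  cong₂ (λ x y → if x then y else not y) (eval-instantiate v σ s) (eval-instantiate v σ t)

everyAssignment : ∀ n → (Vec Bool n → Bool) → Bool
everyAssignment zero    f = f []
everyAssignment (suc n) f =
  everyAssignment n (f ∘ (true ∷_)) ∧ everyAssignment n (f ∘ (false ∷_))

everyAssignment-sound : ∀ n f → T (everyAssignment n f) → ∀ ρ → T (f ρ)
everyAssignment-sound zero    f h [] = h
everyAssignment-sound (suc n) f h (true ∷ ρ)  =
  everyAssignment-sound n _ (proj₁ (Equivalence.to T-∧ h)) ρ
everyAssignment-sound (suc n) f h (false ∷ ρ) =
  everyAssignment-sound n _ (proj₂ (Equivalence.to T-∧ h)) ρ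

tautology : ∀ {n} (s : Schema n) (σ : Vec Fm n) →
  {T (everyAssignment n ⟦ s ⟧)} → ⊢ instantiate σ s
tautology {n} s σ {valid} = taut λ v →
  trans (eval-instantiate v σ s)
        (Equivalence.to T-≡ (everyAssignment-sound n ⟦ s ⟧ valid (map (eval v) σ)))

A : ∀ {n} → Schema (suc n)
A = mv zero
B : ∀ {n} → Schema (suc (suc n))
B = mv (suc zero)
C : ∀ {n} → Schema (suc (suc (suc n)))
C = mv (suc (suc zero))
D : ∀ {n} → Schema (suc (suc (suc (suc n))))
D = mv (suc (suc (suc zero)))
E : ∀ {n} → Schema (suc (suc (suc (suc (suc n)))))
E = mv (suc (suc (suc (suc zero))))
F : ∀ {n} → Schema (suc (suc (suc (suc (suc (suc n))))))
F = mv (suc (suc (suc (suc (suc zero)))))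
G : ∀ {n} → Schema (suc (suc (suc (suc (suc (suc (suc n)))))))
G = mv (suc (suc (suc (suc (suc (suc zero))))))
H : ∀ {n} → Schema (suc (suc (suc (suc (suc (suc (suc (suc n))))))))
H = mv (suc (suc (suc (suc (suc (suc (suc zero)))))))

⇒-refl : ∀ {a} → ⊢ a ⇒ a
⇒-refl {a} = tautology (A ⇒ₛ A) (a ∷ [])

⇒-trans : ∀ {a b c} → ⊢ a ⇒ b → ⊢ b ⇒ c → ⊢ a ⇒ c
⇒-trans {a} {b} {c} = MP ∘ MP (tautology ((A ⇒ₛ B) ⇒ₛ (B ⇒ₛ C) ⇒ₛ (A ⇒ₛ C)) (a ∷ b ∷ c ∷ []))

⇒-contrapose : ∀ {a b} → ⊢ a ⇒ b → ⊢ ¬' b ⇒ ¬' a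
⇒-contrapose {a} {b} = MP (tautology ((A ⇒ₛ B) ⇒ₛ (¬ₛ B ⇒ₛ ¬ₛ A)) (a ∷ b ∷ []))

∧-intro : ∀ {a b} → ⊢ a → ⊢ b → ⊢ a ∧' b
∧-intro {a} {b} = MP ∘ MP (tautology (A ⇒ₛ B ⇒ₛ A ∧ₛ B) (a ∷ b ∷ []))

∧-elim₁ : ∀ {a b} → ⊢ a ∧' b → ⊢ a
∧-elim₁ {a} {b} = MP (tautology (A ∧ₛ B ⇒ₛ A) (a ∷ b ∷ []))

∧-elim₂ : ∀ {a b} → ⊢ a ∧' b → ⊢ b
∧-elim₂ {a} {b} = MP (tautology (A ∧ₛ B ⇒ₛ B) (a ∷ b ∷ []))

∨-intro₁ : ∀ {a b} → ⊢ a → ⊢ a ∨' b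
∨-intro₁ {a} {b} = MP (tautology (A ⇒ₛ A ∨ₛ B) (a ∷ b ∷ []))

∨-intro₂ : ∀ {a b} → ⊢ b → ⊢ a ∨' b
∨-intro₂ {a} {b} = MP (tautology (B ⇒ₛ A ∨ₛ B) (a ∷ b ∷ []))

⇔-refl : ∀ {a} → ⊢ a ⇔ a
⇔-refl {a} = tautology (A ⇔ₛ A) (a ∷ [])

⇔-to : ∀ {a b} → ⊢ a ⇔ b → ⊢ a ⇒ b
⇔-to {a} {b} = MP (tautology ((A ⇔ₛ B) ⇒ₛ (A ⇒ₛ B)) (a ∷ b ∷ []))

⇔-from : ∀ {a b} → ⊢ a ⇔ b → ⊢ b ⇒ a
⇔-from {a} {b} = MP (tautology ((A ⇔ₛ B) ⇒ₛ (B ⇒ₛ A)) (a ∷ b ∷ []))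

∧-mono : ∀ {a b c d} → ⊢ a ⇒ c → ⊢ b ⇒ d → ⊢ a ∧' b ⇒ c ∧' d
∧-mono {a} {b} {c} {d} =
  MP ∘ MP (tautology ((A ⇒ₛ C) ⇒ₛ (B ⇒ₛ D) ⇒ₛ (A ∧ₛ B ⇒ₛ C ∧ₛ D)) (a ∷ b ∷ c ∷ d ∷ []))

∨-mono : ∀ {a b c d} → ⊢ a ⇒ c → ⊢ b ⇒ d → ⊢ a ∨' b ⇒ c ∨' d
∨-mono {a} {b} {c} {d} =
  MP ∘ MP (tautology ((A ⇒ₛ C) ⇒ₛ (B ⇒ₛ D) ⇒ₛ (A ∨ₛ B ⇒ₛ C ∨ₛ D)) (a ∷ b ∷ c ∷ d ∷ []))

∨-elim : ∀ {a b c} → ⊢ a ⇒ c → ⊢ b ⇒ c → ⊢ a ∨' b ⇒ c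
∨-elim {a} {b} {c} = MP ∘ MP (tautology ((A ⇒ₛ C) ⇒ₛ (B ⇒ₛ C) ⇒ₛ (A ∨ₛ B ⇒ₛ C)) (a ∷ b ∷ c ∷ []))

⇒-∨-intro₂ : ∀ {a b} → ⊢ a ⇒ (b ∨' a)
⇒-∨-intro₂ {a} {b} = tautology (A ⇒ₛ B ∨ₛ A) (a ∷ b ∷ [])

□-mono : ∀ {a b} → ⊢ a ⇒ b → ⊢ □ a ⇒ □ b
□-mono h = MP K (Nec□ h)

□-mono₂ : ∀ {a b c} → ⊢ a ⇒ (b ⇒ c) → ⊢ □ a ⇒ (□ b ⇒ □ c)
□-mono₂ h = ⇒-trans (□-mono h) K

□-∧ : ∀ {a b} → ⊢ □ a ∧' □ b ⇒ □ (a ∧' b)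
□-∧ {a} {b} = MP (tautology ((A ⇒ₛ B ⇒ₛ C) ⇒ₛ (A ∧ₛ B ⇒ₛ C)) (□ a ∷ □ b ∷ □ (a ∧' b) ∷ []))
                 (□-mono₂ (tautology (A ⇒ₛ B ⇒ₛ A ∧ₛ B) (a ∷ b ∷ [])))

□-∨ : ∀ {a b} → ⊢ □ a ∨' □ b ⇒ □ (a ∨' b)
□-∨ {a} {b} = ∨-elim (□-mono (tautology (A ⇒ₛ A ∨ₛ B) (a ∷ b ∷ [])))
                     (□-mono (tautology (B ⇒ₛ A ∨ₛ B) (a ∷ b ∷ [])))

[∀]-elim : ∀ {a} → ⊢ [∀] a ⇒ a
[∀]-elim {a} = MP (tautology ((A ⇒ₛ (⊤ₛ ⇒ₛ B)) ⇒ₛ (A ⇒ₛ B)) ([∀] a ∷ a ∷ [])) A4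

-- Add lifts ⊤ ⇝ a to □ ⊤ ⇝ □ a, and □ ⊤ holds by necessitation.
[∀]⇒□ : ∀ {a} → ⊢ [∀] a ⇒ □ a
[∀]⇒□ {a} = MP (MP (MP (tautology ((A ⇒ₛ B) ⇒ₛ (B ⇒ₛ (C ⇒ₛ D)) ⇒ₛ C ⇒ₛ (A ⇒ₛ D))
                 ([∀] a ∷ (□ ⊤' ⇝ □ a) ∷ □ ⊤' ∷ □ a ∷ [])) Add) A4)
               (Nec□ (tautology ⊤ₛ []))

data Global : Fm → Set where
  ⇝-global : ∀ a b → Global (a ⇝ b)
  ¬-global : ∀ {a} → Global a → Global (¬' a)
  ∧-global : ∀ {a b} → Global a → Global b → Global (a ∧' b)
  ∨-global : ∀ {a b} → Global a → Global b → Global (a ∨' b)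

-- Both polarities are needed for the induction to pass through negation.
global-□ : ∀ {a} → Global a → (⊢ a ⇒ □ a) × (⊢ ¬' a ⇒ □ ¬' a)
global-□ (⇝-global a b) =
  ⇒-trans (⇔-to A10) [∀]⇒□ ,
  ⇒-trans (⇒-contrapose (⇔-from A10))
          (⇒-trans A9 (⇒-trans [∀]⇒□ (□-mono (⇒-contrapose (⇔-to A10)))))
global-□ {¬' a} (¬-global g) with global-□ g
... | a⇒□a , ¬a⇒□¬a =
  ¬a⇒□¬a ,
  ⇒-trans (tautology (¬ₛ ¬ₛ A ⇒ₛ A) (a ∷ []))
          (⇒-trans a⇒□a (□-mono (tautology (A ⇒ₛ ¬ₛ ¬ₛ A) (a ∷ []))))
global-□ {a ∧' b} (∧-global ga gb) with global-□ ga | global-□ gb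
... | a⇒□a , ¬a⇒□¬a | b⇒□b , ¬b⇒□¬b =
  ⇒-trans (∧-mono a⇒□a b⇒□b) □-∧ ,
  ⇒-trans (tautology (¬ₛ (A ∧ₛ B) ⇒ₛ ¬ₛ A ∨ₛ ¬ₛ B) (a ∷ b ∷ []))
    (⇒-trans (∨-mono ¬a⇒□¬a ¬b⇒□¬b)
      (⇒-trans □-∨ (□-mono (tautology (¬ₛ A ∨ₛ ¬ₛ B ⇒ₛ ¬ₛ (A ∧ₛ B)) (a ∷ b ∷ [])))))
global-□ {a ∨' b} (∨-global ga gb) with global-□ ga | global-□ gb
... | a⇒□a , ¬a⇒□¬a | b⇒□b , ¬b⇒□¬b =
  ⇒-trans (∨-mono a⇒□a b⇒□b) □-∨ ,
  ⇒-trans (tautology (¬ₛ (A ∨ₛ B) ⇒ₛ ¬ₛ A ∧ₛ ¬ₛ B) (a ∷ b ∷ []))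
    (⇒-trans (∧-mono ¬a⇒□¬a ¬b⇒□¬b)
      (⇒-trans □-∧ (□-mono (tautology (¬ₛ A ∧ₛ ¬ₛ B ⇒ₛ ¬ₛ (A ∨ₛ B)) (a ∷ b ∷ [])))))

∨-false : ∀ {x y} → x ∨ y ≡ false → x ≡ false × y ≡ false
∨-false {false} y≡false = refl , y≡false

isConj : Fm → Bool
isConj (_ ∧' _) = true
isConj _        = false

data Shape : Fm → Fm → Set where
  split-∨ : ∀ x y c → Shape (x ∨' y) c
  contra  : ∀ x y → Shape (¬' x) (¬' y)
  split-∧ : ∀ a c d → Shape a (c ∧' d)
  atomic  : ∀ a b → isConj b ≡ false → Shape a b

shape : ∀ a b → Shape a b
shape (x ∨' y) c     = split-∨ x y c
shape (¬' x) (¬' y)  = contra x y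
shape a (c ∧' d)     = split-∧ a c d
shape a (var n)      = atomic a _ refl
shape a ⊤'           = atomic a _ refl
shape a ⊥'           = atomic a _ refl
shape a (¬' b)       = atomic a _ refl
shape a (b ∨' c)     = atomic a _ refl
shape a (b ⇒ c)      = atomic a _ refl
shape a (b ⇔ c)      = atomic a _ refl
shape a (b ⇝ c)      = atomic a _ refl
shape a (□ b)        = atomic a _ refl

data ExtraShape : Fm → Fm → Set where
  □-□   : ∀ x y → ExtraShape (□ x) (□ y)
  ⊤-⇝   : ∀ x y → ExtraShape ⊤' (x ⇝ y)
  ⊤-¬⇝  : ∀ x y → ExtraShape ⊤' (¬' (x ⇝ y))
  ¬⇝-⊥  : ∀ x y → ExtraShape (¬' (x ⇝ y)) ⊥'
  plain : ∀ a b → ExtraShape a b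

extraShape : ∀ a b → ExtraShape a b
extraShape (□ x) (□ y)          = □-□ x y
extraShape ⊤' (x ⇝ y)           = ⊤-⇝ x y
extraShape ⊤' (¬' (x ⇝ y))      = ⊤-¬⇝ x y
extraShape (¬' (x ⇝ y)) ⊥'      = ¬⇝-⊥ x y
extraShape a b                  = plain a b

module Translation (p : ℕ) (φ : Fm) where

  mentions : Fm → Bool
  mentions (var n)  = n ≡ᵇ p
  mentions ⊤'       = false
  mentions ⊥'       = false
  mentions (¬' a)   = mentions a
  mentions (a ∧' b) = mentions a ∨ mentions b
  mentions (a ∨' b) = mentions a ∨ mentions b
  mentions (a ⇒ b)  = mentions a ∨ mentions b
  mentions (a ⇔ b)  = mentions a ∨ mentions b
  mentions (a ⇝ b)  = mentions a ∨ mentions b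
  mentions (□ a)    = mentions a

  infix 6 _⇝ᵗ_

  mutual
    tr : Fm → Fm
    tr (var n)  = if n ≡ᵇ p then φ else var n
    tr ⊤'       = ⊤'
    tr ⊥'       = ⊥'
    tr (¬' a)   = ¬' tr a
    tr (a ∧' b) = tr a ∧' tr b
    tr (a ∨' b) = tr a ∨' tr b
    tr (a ⇒ b)  = tr a ⇒ tr b
    tr (a ⇔ b)  = tr a ⇔ tr b
    tr (a ⇝ b)  = a ⇝ᵗ b
    tr (□ a)    = □ tr a

    _⇝ᵗ_ : Fm → Fm → Fm
    a ⇝ᵗ b = if mentions a ∨ mentions b then unfold (shape a b) else a ⇝ b

    unfold : ∀ {a b} → Shape a b → Fm
    unfold (split-∨ x y c) = (x ⇝ᵗ c) ∧' (y ⇝ᵗ c)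
    unfold (contra x y)    = y ⇝ᵗ x
    unfold (split-∧ a c d) = (a ⇝ᵗ c) ∧' (a ⇝ᵗ d)
    unfold (atomic a b _)  = (tr a ⇝ tr b) ∨' extra (extraShape a b)

    -- The special cases serve Add, A10 (and A8), A9 and A11 respectively.
    extra : ∀ {a b} → ExtraShape a b → Fm
    extra (□-□ x y)   = x ⇝ᵗ y
    extra (⊤-⇝ x y)   = x ⇝ᵗ y
    extra (⊤-¬⇝ x y)  = ¬' (x ⇝ᵗ y)
    extra (¬⇝-⊥ x y)  = x ⇝ᵗ y
    extra (plain a b) = [∀] (tr a ⇒ tr b)

  ⇝ᵗ-fresh : ∀ {a b} → mentions a ≡ false → mentions b ≡ false → a ⇝ᵗ b ≡ a ⇝ b
  ⇝ᵗ-fresh a-fresh b-fresh rewrite a-fresh | b-fresh = refl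

  tr-fresh : ∀ a → mentions a ≡ false → tr a ≡ a
  tr-fresh (var n)  fresh rewrite fresh = refl
  tr-fresh ⊤'       fresh = refl
  tr-fresh ⊥'       fresh = refl
  tr-fresh (¬' a)   fresh = cong ¬'_ (tr-fresh a fresh)
  tr-fresh (a ∧' b) fresh =
    cong₂ _∧'_ (tr-fresh a (proj₁ (∨-false fresh))) (tr-fresh b (proj₂ (∨-false fresh)))
  tr-fresh (a ∨' b) fresh =
    cong₂ _∨'_ (tr-fresh a (proj₁ (∨-false fresh))) (tr-fresh b (proj₂ (∨-false fresh)))
  tr-fresh (a ⇒ b)  fresh =
    cong₂ _⇒_ (tr-fresh a (proj₁ (∨-false fresh))) (tr-fresh b (proj₂ (∨-false fresh)))
  tr-fresh (a ⇔ b)  fresh =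
    cong₂ _⇔_ (tr-fresh a (proj₁ (∨-false fresh))) (tr-fresh b (proj₂ (∨-false fresh)))
  tr-fresh (a ⇝ b)  fresh = ⇝ᵗ-fresh (proj₁ (∨-false fresh)) (proj₂ (∨-false fresh))
  tr-fresh (□ a)    fresh = cong □_ (tr-fresh a fresh)

  mutual
    ⇝ᵗ-global : ∀ a b → Global (a ⇝ᵗ b)
    ⇝ᵗ-global a b with mentions a ∨ mentions b
    ... | false = ⇝-global a b
    ... | true  = unfold-global (shape a b)

    unfold-global : ∀ {a b} (s : Shape a b) → Global (unfold s)
    unfold-global (split-∨ x y c) = ∧-global (⇝ᵗ-global x c) (⇝ᵗ-global y c)
    unfold-global (contra x y)    = ⇝ᵗ-global y x
    unfold-global (split-∧ a c d) = ∧-global (⇝ᵗ-global a c) (⇝ᵗ-global a d)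
    unfold-global (atomic a b _)  = ∨-global (⇝-global _ _) (extra-global (extraShape a b))

    extra-global : ∀ {a b} (e : ExtraShape a b) → Global (extra e)
    extra-global (□-□ x y)   = ⇝ᵗ-global x y
    extra-global (⊤-⇝ x y)   = ⇝ᵗ-global x y
    extra-global (⊤-¬⇝ x y)  = ¬-global (⇝ᵗ-global x y)
    extra-global (¬⇝-⊥ x y)  = ⇝ᵗ-global x y
    extra-global (plain a b) = ⇝-global _ _

  mutual
    ⇝ᵗ-elim : ∀ a b → ⊢ (a ⇝ᵗ b) ⇒ (tr a ⇒ tr b)
    ⇝ᵗ-elim a b with mentions a ∨ mentions b in fresh
    ... | false rewrite tr-fresh a (proj₁ (∨-false fresh))
                      | tr-fresh b (proj₂ (∨-false fresh)) = A4
    ... | true  = unfold-elim (shape a b)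

    unfold-elim : ∀ {a b} (s : Shape a b) → ⊢ unfold s ⇒ (tr a ⇒ tr b)
    unfold-elim (split-∨ x y c) =
      MP (MP (tautology ((A ⇒ₛ (C ⇒ₛ E)) ⇒ₛ (B ⇒ₛ (D ⇒ₛ E)) ⇒ₛ (A ∧ₛ B ⇒ₛ (C ∨ₛ D ⇒ₛ E)))
                        (x ⇝ᵗ c ∷ y ⇝ᵗ c ∷ tr x ∷ tr y ∷ tr c ∷ []))
             (⇝ᵗ-elim x c)) (⇝ᵗ-elim y c)
    unfold-elim (contra x y) =
      MP (tautology ((A ⇒ₛ (B ⇒ₛ C)) ⇒ₛ (A ⇒ₛ (¬ₛ C ⇒ₛ ¬ₛ B))) (y ⇝ᵗ x ∷ tr y ∷ tr x ∷ []))
         (⇝ᵗ-elim y x)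
    unfold-elim (split-∧ a c d) =
      MP (MP (tautology ((A ⇒ₛ (C ⇒ₛ D)) ⇒ₛ (B ⇒ₛ (C ⇒ₛ E)) ⇒ₛ (A ∧ₛ B ⇒ₛ (C ⇒ₛ D ∧ₛ E)))
                        (a ⇝ᵗ c ∷ a ⇝ᵗ d ∷ tr a ∷ tr c ∷ tr d ∷ []))
             (⇝ᵗ-elim a c)) (⇝ᵗ-elim a d)
    unfold-elim (atomic a b _) = ∨-elim A4 (extra-elim (extraShape a b))

    extra-elim : ∀ {a b} (e : ExtraShape a b) → ⊢ extra e ⇒ (tr a ⇒ tr b)
    extra-elim (□-□ x y) =
      ⇒-trans (proj₁ (global-□ (⇝ᵗ-global x y))) (□-mono₂ (⇝ᵗ-elim x y))
    extra-elim (⊤-⇝ x y)   = tautology (A ⇒ₛ (⊤ₛ ⇒ₛ A)) (x ⇝ᵗ y ∷ [])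
    extra-elim (⊤-¬⇝ x y)  = tautology (¬ₛ A ⇒ₛ (⊤ₛ ⇒ₛ ¬ₛ A)) (x ⇝ᵗ y ∷ [])
    extra-elim (¬⇝-⊥ x y)  = tautology (A ⇒ₛ (¬ₛ A ⇒ₛ ⊥ₛ)) (x ⇝ᵗ y ∷ [])
    extra-elim (plain a b) = [∀]-elim

  ⊥⇝ᵗ : ∀ c → ⊢ ⊥' ⇝ᵗ c
  ⊥⇝ᵗ c with mentions c
  ... | false = ∧-elim₁ A1
  ... | true with shape ⊥' c
  ...   | split-∧ _ c₁ c₂ = ∧-intro (⊥⇝ᵗ c₁) (⊥⇝ᵗ c₂)
  ...   | atomic _ _ _    = ∨-intro₁ (∧-elim₁ A1)

  ⇝ᵗ⊤ : ∀ a → ⊢ a ⇝ᵗ ⊤'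
  ⇝ᵗ⊤ a with mentions a ∨ false
  ... | false = ∧-elim₂ A1
  ... | true with shape a ⊤'
  ...   | split-∨ x y _ = ∧-intro (⇝ᵗ⊤ x) (⇝ᵗ⊤ y)
  ...   | atomic _ _ _  = ∨-intro₁ (∧-elim₂ A1)

  A2ᵗ : ∀ x y c → ⊢ ((x ∨' y) ⇝ᵗ c) ⇔ ((x ⇝ᵗ c) ∧' (y ⇝ᵗ c))
  A2ᵗ x y c with mentions x | mentions y | mentions c
  ... | false | false | false = A2
  ... | true  | _     | _     = ⇔-refl
  ... | false | true  | _     = ⇔-refl
  ... | false | false | true  = ⇔-refl

  A3ᵗ : ∀ a b c → ⊢ (a ⇝ᵗ (b ∧' c)) ⇔ ((a ⇝ᵗ b) ∧' (a ⇝ᵗ c))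
  A3ᵗ a b c with mentions a ∨ (mentions b ∨ mentions c) in fresh
  ... | false = subst (λ χ → ⊢ (a ⇝ (b ∧' c)) ⇔ χ)
                      (sym (cong₂ _∧'_ (⇝ᵗ-fresh a-fresh b-fresh) (⇝ᵗ-fresh a-fresh c-fresh))) A3
    where
    a-fresh : mentions a ≡ false
    a-fresh = proj₁ (∨-false fresh)
    b-fresh : mentions b ≡ false
    b-fresh = proj₁ (∨-false (proj₂ (∨-false {mentions a} fresh)))
    c-fresh : mentions c ≡ false
    c-fresh = proj₂ (∨-false (proj₂ (∨-false {mentions a} fresh)))
  ... | true with shape a (b ∧' c)
  ...   | split-∧ _ _ _  = ⇔-refl
  ...   | atomic _ _ ()
  ...   | split-∨ x y _ =
    MP (MP (MP (MP (tautology ((A ⇔ₛ C ∧ₛ D) ⇒ₛ (B ⇔ₛ E ∧ₛ F) ⇒ₛ (G ⇔ₛ C ∧ₛ E) ⇒ₛ (H ⇔ₛ D ∧ₛ F)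
                               ⇒ₛ (A ∧ₛ B ⇔ₛ G ∧ₛ H))
                              (x ⇝ᵗ (b ∧' c) ∷ y ⇝ᵗ (b ∧' c) ∷ x ⇝ᵗ b ∷ x ⇝ᵗ c ∷ y ⇝ᵗ b ∷ y ⇝ᵗ c
                               ∷ (x ∨' y) ⇝ᵗ b ∷ (x ∨' y) ⇝ᵗ c ∷ []))
                   (A3ᵗ x b c)) (A3ᵗ y b c)) (A2ᵗ x y b)) (A2ᵗ x y c)

  A5ᵗ : ∀ a b → ⊢ (a ⇝ᵗ b) ⇔ (¬' b ⇝ᵗ ¬' a)
  A5ᵗ a b with mentions b ∨ mentions a in fresh
  ... | true  = ⇔-refl
  ... | false = subst (λ χ → ⊢ χ ⇔ (¬' b ⇝ ¬' a))
                      (sym (⇝ᵗ-fresh (proj₂ (∨-false fresh)) (proj₁ (∨-false fresh)))) A5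

  A8ᵗ : ∀ a → ⊢ (⊤' ⇝ᵗ a) ⇒ (⊤' ⇝ᵗ (⊤' ⇝ a))
  A8ᵗ a with mentions a
  ... | false = A8
  ... | true  = ⇒-∨-intro₂

  A9ᵗ : ∀ a → ⊢ ¬' (⊤' ⇝ᵗ a) ⇒ (⊤' ⇝ᵗ ¬' (⊤' ⇝ a))
  A9ᵗ a with mentions a
  ... | false = A9
  ... | true  = ⇒-∨-intro₂

  A10ᵗ : ∀ a b → ⊢ (a ⇝ᵗ b) ⇔ (⊤' ⇝ᵗ (a ⇝ b))
  A10ᵗ a b with mentions a ∨ mentions b
  ... | false = A10
  ... | true  =
    MP (tautology ((B ⇒ₛ A) ⇒ₛ (A ⇔ₛ B ∨ₛ A)) (unfold (shape a b) ∷ [∀] unfold (shape a b) ∷ []))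
       [∀]-elim

  A11ᵗ : ∀ a → ⊢ (⊤' ⇝ᵗ a) ⇒ (¬' (⊤' ⇝ a) ⇝ᵗ ⊥')
  A11ᵗ a with mentions a
  ... | false = A11
  ... | true  = ⇒-∨-intro₂

  Addᵗ : ∀ a b → ⊢ (a ⇝ᵗ b) ⇒ (□ a ⇝ᵗ □ b)
  Addᵗ a b with mentions a ∨ mentions b
  ... | false = Add
  ... | true  = ⇒-∨-intro₂

  Nec∀ᵗ : ∀ a → ⊢ tr a → ⊢ ⊤' ⇝ᵗ a
  Nec∀ᵗ a ⊢tr-a with mentions a in fresh
  ... | false = Nec∀ (subst ⊢_ (tr-fresh a fresh) ⊢tr-a)
  ... | true with shape ⊤' a
  ...   | split-∧ _ c d = ∧-intro (Nec∀ᵗ c (∧-elim₁ ⊢tr-a)) (Nec∀ᵗ d (∧-elim₂ ⊢tr-a))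
  ...   | atomic _ _ _  = ∨-intro₁ (Nec∀ ⊢tr-a)

  eval-tr : ∀ v a → eval v (tr a) ≡ eval (eval v ∘ tr) a
  eval-tr v (var n)  = refl
  eval-tr v ⊤'       = refl
  eval-tr v ⊥'       = refl
  eval-tr v (¬' a)   = cong not (eval-tr v a)
  eval-tr v (a ∧' b) = cong₂ _∧_ (eval-tr v a) (eval-tr v b)
  eval-tr v (a ∨' b) = cong₂ _∨_ (eval-tr v a) (eval-tr v b)
  eval-tr v (a ⇒ b)  = cong₂ (λ x y → not x ∨ y) (eval-tr v a) (eval-tr v b)
  eval-tr v (a ⇔ b)  = cong₂ (λ x y → if x then y else not y) (eval-tr v a) (eval-tr v b)
  eval-tr v (a ⇝ b)  = refl
  eval-tr v (□ a)    = refl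

  tr-⊢ : ∀ {a} → ⊢ a → ⊢ tr a
  tr-⊢ (taut {a} t)       = taut λ v → trans (eval-tr v a) (t (eval v ∘ tr))
  tr-⊢ (A1 {c})           = ∧-intro (⊥⇝ᵗ c) (⇝ᵗ⊤ c)
  tr-⊢ (A2 {x} {y} {c})   = A2ᵗ x y c
  tr-⊢ (A3 {a} {b} {c})   = A3ᵗ a b c
  tr-⊢ (A4 {a} {b})       = ⇝ᵗ-elim a b
  tr-⊢ (A5 {a} {b})       = A5ᵗ a b
  tr-⊢ (A8 {a})           = A8ᵗ a
  tr-⊢ (A9 {a})           = A9ᵗ a
  tr-⊢ (A10 {a} {b})      = A10ᵗ a b
  tr-⊢ (A11 {a})          = A11ᵗ a
  tr-⊢ K                  = K
  tr-⊢ (Add {a} {b})      = Addᵗ a b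
  tr-⊢ (MP ⊢a⇒b ⊢a)       = MP (tr-⊢ ⊢a⇒b) (tr-⊢ ⊢a)
  tr-⊢ (Nec∀ {a} ⊢a)      = Nec∀ᵗ a (tr-⊢ ⊢a)
  tr-⊢ (Nec□ ⊢a)          = Nec□ (tr-⊢ ⊢a)

  p≡ᵇp : (p ≡ᵇ p) ≡ true
  p≡ᵇp = Equivalence.to T-≡ (≡⇒≡ᵇ p p refl)

  tr-p : tr (var p) ≡ φ
  tr-p rewrite p≡ᵇp = refl

  p⇝ᵗ : ∀ b → ⊢ φ ⇒ tr b → ⊢ var p ⇝ᵗ b
  p⇝ᵗ b ⊢φ⇒b rewrite p≡ᵇp with shape (var p) b
  ... | split-∧ _ c d = ∧-intro (p⇝ᵗ c (⇒-trans ⊢φ⇒b (tautology (A ∧ₛ B ⇒ₛ A) (tr c ∷ tr d ∷ []))))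
                                (p⇝ᵗ d (⇒-trans ⊢φ⇒b (tautology (A ∧ₛ B ⇒ₛ B) (tr c ∷ tr d ∷ []))))
  ... | atomic _ _ _  = ∨-intro₂ (Nec∀ (subst (λ χ → ⊢ χ ⇒ tr b) (sym tr-p) ⊢φ⇒b))

  mentions⇒occursIn : ∀ a → mentions a ≡ true → p occursIn a
  mentions⇒occursIn (var n) eq =
    subst (λ m → p occursIn var m) (sym (≡ᵇ⇒≡ n p (Equivalence.from T-≡ eq))) here
  mentions⇒occursIn (¬' a) eq = ¬o (mentions⇒occursIn a eq)
  mentions⇒occursIn (a ∧' b) eq with mentions a in ma
  ... | true  = ∧l (mentions⇒occursIn a ma)
  ... | false = ∧r (mentions⇒occursIn b eq)
  mentions⇒occursIn (a ∨' b) eq with mentions a in ma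
  ... | true  = ∨l (mentions⇒occursIn a ma)
  ... | false = ∨r (mentions⇒occursIn b eq)
  mentions⇒occursIn (a ⇒ b) eq with mentions a in ma
  ... | true  = ⇒l (mentions⇒occursIn a ma)
  ... | false = ⇒r (mentions⇒occursIn b eq)
  mentions⇒occursIn (a ⇔ b) eq with mentions a in ma
  ... | true  = ⇔l (mentions⇒occursIn a ma)
  ... | false = ⇔r (mentions⇒occursIn b eq)
  mentions⇒occursIn (a ⇝ b) eq with mentions a in ma
  ... | true  = ⇝l (mentions⇒occursIn a ma)
  ... | false = ⇝r (mentions⇒occursIn b eq)
  mentions⇒occursIn (□ a) eq = □o (mentions⇒occursIn a eq)

  ¬occursIn⇒fresh : ∀ a → ¬ (p occursIn a) → mentions a ≡ false
  ¬occursIn⇒fresh a p∉a with mentions a in eq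
  ... | false = refl
  ... | true  = ⊥-elim (p∉a (mentions⇒occursIn a eq))

theorem4p21 : (p : ℕ) (φ ψ : Fm) → ¬ (p occursIn φ) → ¬ (p occursIn ψ)
    → ⊢ (((var p ⇝ φ) ∧' ◇ var p) ⇒ ψ) → ⊢ (◇ φ ⇒ ψ)
theorem4p21 p φ ψ p∉φ p∉ψ ⊢hyp =
  MP (MP (tautology ((A ∧ₛ B ⇒ₛ C) ⇒ₛ A ⇒ₛ (B ⇒ₛ C)) (var p ⇝ᵗ φ ∷ ◇ φ ∷ ψ ∷ [])) ⊢hypᵗ) ⊢p⇝ᵗφ
  where
  open Translation p φ

  ⊢hypᵗ : ⊢ ((var p ⇝ᵗ φ) ∧' ◇ φ) ⇒ ψ
  ⊢hypᵗ = subst ⊢_ (cong₂ (λ χ ω → ((var p ⇝ᵗ φ) ∧' ◇ χ) ⇒ ω)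
                          tr-p (tr-fresh ψ (¬occursIn⇒fresh ψ p∉ψ)))
                   (tr-⊢ ⊢hyp)

  ⊢p⇝ᵗφ : ⊢ var p ⇝ᵗ φ
  ⊢p⇝ᵗφ = p⇝ᵗ φ (subst (λ χ → ⊢ φ ⇒ χ) (sym (tr-fresh φ (¬occursIn⇒fresh φ p∉φ))) ⇒-refl)
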